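{- Let $(\mathbf{M},\mathbf{N})$ be an $\mathrm{IMLU}$-category and $n\in\mathbb{N}$. If $u:A_1\times\dots\times A_n\to B$ is a morphism in $\mathbf{N}$, then there is a morphism $v:\mathbf{T}A_1\times\dots\times\mathbf{T}A_n\to\mathbf{T}B$ in $\mathbf{N}$ such that $\iota_B\circ u=v\circ(\iota_{A_1}\times\dots\times\iota_{A_n})$.
   Context: Heyting category: finite limits, images, covers stable under pullback, each subobject poset a join-semilattice, each pullback map $f^*$ preserving finite joins with adjoints $\exists_f\dashv f^*\dashv\forall_f$. An $\mathrm{IMLU}$-category is a pair $(\mathbf{M},\mathbf{N})$ of Heyting categories with $\mathbf{N}$ a conservative (isomorphism-reflecting) Heyting subcategory of $\mathbf{M}$, together with: an object $U$ of $\mathbf{N}$ such that every object of $\mathbf{N}$ has a mono in $\mathbf{N}$ into $U$; an endofunctor $\mathbf{T}$ of $\mathbf{M}$ restricting to an endofunctor of $\mathbf{N}$ and a natural isomorphism $\iota:\mathrm{id}_\mathbf{M}\to\mathbf{T}$ on $\mathbf{M}$ (whose components need not lie in $\mathbf{N}$); an endofunctor $\mathbf{P}$ of $\mathbf{N}$ such that for each object $A$ of $\mathbf{N}$ there is $m_{\subseteq^\mathbf{T}_A}:\subseteq^\mathbf{T}_A\to\mathbf{T}A\times\mathbf{P}A$ in $\mathbf{N}$, monic in $\mathbf{M}$, such that for each $r:R\to\mathbf{T}A\times B$ in $\mathbf{N}$ monic in $\mathbf{M}$ there is $\chi:B\to\mathbf{P}A$ in $\mathbf{N}$ which is the unique morphism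 of $\mathbf{M}$ for which $r$ is a pullback in $\mathbf{M}$ of $m_{\subseteq^\mathbf{T}_A}$ along $\mathrm{id}\times\chi$; and a natural isomorphism $\mu:\mathbf{P}\mathbf{T}\to\mathbf{T}\mathbf{P}$ on $\mathbf{N}$. Products are fixed in $\mathbf{M}$ and restrict to products in $\mathbf{N}$. -}

module Defs where

open import Level using (Level; _⊔_) renaming (suc to lsuc)
open import Data.Product using (Σ; _×_; _,_; proj₁; proj₂)
open import Data.Nat using (ℕ; zero; suc)
open import Data.Fin using (Fin) renaming (zero to fzero; suc to fsuc)
open import Relation.Binary using (IsEquivalence)

record Category (o h e : Level) : Set (lsuc (o ⊔ h ⊔ e)) where
  infixr 9 _∘_
  infix 4 _≈_
  infix 5 _⇒_
  field
    Obj : Set o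
    _⇒_ : Obj → Obj → Set h
    _≈_ : ∀ {A B} → A ⇒ B → A ⇒ B → Set e
    id : ∀ {A} → A ⇒ A
    _∘_ : ∀ {A B C} → B ⇒ C → A ⇒ B → A ⇒ C
    equiv : ∀ {A B} → IsEquivalence (_≈_ {A} {B})
    ∘-resp-≈ : ∀ {A B C} {f g : B ⇒ C} {k l : A ⇒ B} → f ≈ g → k ≈ l → f ∘ k ≈ g ∘ l
    assoc : ∀ {A B C D} {f : A ⇒ B} {g : B ⇒ C} {k : C ⇒ D} → (k ∘ g) ∘ f ≈ k ∘ (g ∘ f)
    identityˡ : ∀ {A B} {f : A ⇒ B} → id ∘ f ≈ f
    identityʳ : ∀ {A B} {f : A ⇒ B} → f ∘ id ≈ f

record Functor {o h e o' h' e' : Level} (C : Category o h e) (D : Category o' h' e')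
       : Set (o ⊔ h ⊔ e ⊔ o' ⊔ h' ⊔ e') where
  private
    module C = Category C
    module D = Category D
  field
    F₀ : C.Obj → D.Obj
    F₁ : ∀ {A B} → A C.⇒ B → F₀ A D.⇒ F₀ B
    F-resp-≈ : ∀ {A B} {f g : A C.⇒ B} → f C.≈ g → F₁ f D.≈ F₁ g
    F-id : ∀ {A} → F₁ (C.id {A}) D.≈ D.id
    F-∘ : ∀ {A B C} {f : A C.⇒ B} {g : B C.⇒ C} → F₁ (g C.∘ f) D.≈ F₁ g D.∘ F₁ f

module Notions {o h e : Level} (C : Category o h e) where
  open Category C

  ℓ : Level
  ℓ = o ⊔ h ⊔ e

  IsMono : ∀ {A B} → A ⇒ B → Set ℓ
  IsMono {A} f = ∀ {X} (g k : X ⇒ A) → f ∘ g ≈ f ∘ k → g ≈ k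

  IsIso : ∀ {A B} → A ⇒ B → Set (h ⊔ e)
  IsIso {A} {B} f = Σ (B ⇒ A) λ g → (g ∘ f ≈ id) × (f ∘ g ≈ id)

  IsTerminal : Obj → Set ℓ
  IsTerminal T = ∀ X → Σ (X ⇒ T) λ ! → ∀ (g : X ⇒ T) → g ≈ !

  IsProduct : ∀ {P A B} → P ⇒ A → P ⇒ B → Set ℓ
  IsProduct {P} {A} {B} p₁ p₂ =
    ∀ {X} (f : X ⇒ A) (g : X ⇒ B) → Σ (X ⇒ P) λ k →
      (p₁ ∘ k ≈ f) × (p₂ ∘ k ≈ g) × (∀ (k' : X ⇒ P) → p₁ ∘ k' ≈ f → p₂ ∘ k' ≈ g → k' ≈ k)

  -- the square  p₂ ; g = p₁ ; f  is a pullback (p₁ is the pullback of g along f)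
  IsPullback : ∀ {P A B D} → P ⇒ A → P ⇒ B → A ⇒ D → B ⇒ D → Set ℓ
  IsPullback {P} {A} {B} p₁ p₂ f g =
    (f ∘ p₁ ≈ g ∘ p₂) ×
    (∀ {X} (a : X ⇒ A) (b : X ⇒ B) → f ∘ a ≈ g ∘ b → Σ (X ⇒ P) λ k →
      (p₁ ∘ k ≈ a) × (p₂ ∘ k ≈ b) × (∀ (k' : X ⇒ P) → p₁ ∘ k' ≈ a → p₂ ∘ k' ≈ b → k' ≈ k))

  record Product (A B : Obj) : Set ℓ where
    field
      obj : Obj
      π₁ : obj ⇒ A
      π₂ : obj ⇒ B
      isProduct : IsProduct π₁ π₂

  record Pullback {A B D : Obj} (f : A ⇒ D) (g : B ⇒ D) : Set ℓ where
    field
      obj : Obj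
      p₁ : obj ⇒ A
      p₂ : obj ⇒ B
      isPullback : IsPullback p₁ p₂ f g

  record FiniteLimits : Set ℓ where
    field
      ⊤ : Obj
      isTerminal : IsTerminal ⊤
      product : ∀ A B → Product A B
      pullback : ∀ {A B D} (f : A ⇒ D) (g : B ⇒ D) → Pullback f g

  _≤_ : ∀ {X Y A} → X ⇒ A → Y ⇒ A → Set (h ⊔ e)
  _≤_ {X} {Y} m n = Σ (X ⇒ Y) λ k → n ∘ k ≈ m

  -- monomorphisms into A (representatives of subobjects of A)
  record Mono (A : Obj) : Set ℓ where
    field
      dom : Obj
      arr : dom ⇒ A
      isMono : IsMono arr
  open Mono public

  IsCover : ∀ {A B} → A ⇒ B → Set ℓ
  IsCover {A} {B} f = ∀ {Y} (m : Y ⇒ B) (g : A ⇒ Y) → IsMono m → m ∘ g ≈ f → IsIso m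

  IsImage : ∀ {X A} → X ⇒ A → Mono A → Set ℓ
  IsImage {X} {A} f m = (f ≤ arr m) × (∀ (n : Mono A) → f ≤ arr n → arr m ≤ arr n)

  IsBottom : ∀ {X A} → X ⇒ A → Set ℓ
  IsBottom {X} {A} b = ∀ (n : Mono A) → b ≤ arr n

  IsJoin : ∀ {X Y Z A} → X ⇒ A → Y ⇒ A → Z ⇒ A → Set ℓ
  IsJoin {A = A} m n j =
    (m ≤ j) × (n ≤ j) × (∀ (k : Mono A) → m ≤ arr k → n ≤ arr k → j ≤ arr k)

  module WithLimits (L : FiniteLimits) where
    open FiniteLimits L

    -- f^* applied to a mono n (via the chosen pullback)
    pb* : ∀ {A B} → (f : A ⇒ B) → (n : Mono B) → Pullback.obj (pullback f (arr n)) ⇒ A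
    pb* f n = Pullback.p₁ (pullback f (arr n))

    IsExists : ∀ {A B} → A ⇒ B → Mono A → Mono B → Set ℓ
    IsExists {A} {B} f m e' = ∀ (n : Mono B) →
      (arr e' ≤ arr n → arr m ≤ pb* f n) × (arr m ≤ pb* f n → arr e' ≤ arr n)

    IsForall : ∀ {A B} → A ⇒ B → Mono A → Mono B → Set ℓ
    IsForall {A} {B} f m a = ∀ (n : Mono B) →
      (pb* f n ≤ arr m → arr n ≤ arr a) × (arr n ≤ arr a → pb* f n ≤ arr m)

    record IsHeyting : Set ℓ where
      field
        image : ∀ {X A} (f : X ⇒ A) → Σ (Mono A) (IsImage f)
        cover-stable : ∀ {P A B D} {p₁ : P ⇒ A} {p₂ : P ⇒ B} {f : A ⇒ D} {g : B ⇒ D} →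
          IsPullback p₁ p₂ f g → IsCover g → IsCover p₁
        bottom : ∀ A → Σ (Mono A) λ b → IsBottom (arr b)
        join : ∀ {A} (m n : Mono A) → Σ (Mono A) λ j → IsJoin (arr m) (arr n) (arr j)
        pb*-bottom : ∀ {A B} (f : A ⇒ B) (b : Mono B) → IsBottom (arr b) → IsBottom (pb* f b)
        pb*-join : ∀ {A B} (f : A ⇒ B) (m n j : Mono B) →
          IsJoin (arr m) (arr n) (arr j) → IsJoin (pb* f m) (pb* f n) (pb* f j)
        existsᶠ : ∀ {A B} (f : A ⇒ B) (m : Mono A) → Σ (Mono B) (IsExists f m)
        forallᶠ : ∀ {A B} (f : A ⇒ B) (m : Mono A) → Σ (Mono B) (IsForall f m)

module NaryProducts {o h e : Level} (C : Category o h e) (L : Notions.FiniteLimits C) where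
  open Category C
  open Notions C
  open FiniteLimits L

  infixr 7 _×₀_ _⊗_
  _×₀_ : Obj → Obj → Obj
  A ×₀ B = Product.obj (product A B)

  ⟨_,_⟩ : ∀ {X A B} → X ⇒ A → X ⇒ B → X ⇒ A ×₀ B
  ⟨_,_⟩ {A = A} {B} f g = proj₁ (Product.isProduct (product A B) f g)

  _⊗_ : ∀ {A A' B B'} → A ⇒ A' → B ⇒ B' → A ×₀ B ⇒ A' ×₀ B'
  _⊗_ {A} {A'} {B} {B'} f g =
    ⟨ f ∘ Product.π₁ (product A B) , g ∘ Product.π₂ (product A B) ⟩

  ∏ : ∀ n → (Fin n → Obj) → Obj
  ∏ zero A = ⊤
  ∏ (suc zero) A = A fzero
  ∏ (suc (suc n)) A = A fzero ×₀ ∏ (suc n) (λ i → A (fsuc i))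

  ∏₁ : ∀ n {A B : Fin n → Obj} → (∀ i → A i ⇒ B i) → ∏ n A ⇒ ∏ n B
  ∏₁ zero f = id
  ∏₁ (suc zero) f = f fzero
  ∏₁ (suc (suc n)) f = f fzero ⊗ ∏₁ (suc n) (λ i → f (fsuc i))

record Subcategory {o h e : Level} (C : Category o h e) (p : Level)
       : Set (o ⊔ h ⊔ e ⊔ lsuc p) where
  open Category C
  field
    NObj : Obj → Set p
    NHom : ∀ {A B} → A ⇒ B → Set p
    NHom-resp : ∀ {A B} {f g : A ⇒ B} → f ≈ g → NHom f → NHom g
    NHom-id : ∀ {A} → NObj A → NHom (id {A})
    NHom-∘ : ∀ {A B D} {f : B ⇒ D} {g : A ⇒ B} → NHom f → NHom g → NHom (f ∘ g)

record NArr {o h e p : Level} {C : Category o h e} (S : Subcategory C p)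
       (a b : Σ (Category.Obj C) (Subcategory.NObj S)) : Set (h ⊔ p) where
  constructor _,ₙ_
  field
    hom : Category._⇒_ C (proj₁ a) (proj₁ b)
    inN : Subcategory.NHom S hom
open NArr public

induced : ∀ {o h e p} {C : Category o h e} → Subcategory C p → Category (o ⊔ p) (h ⊔ p) e
induced {C = C} S = record
  { Obj = Σ Obj NObj
  ; _⇒_ = NArr S
  ; _≈_ = λ f g → hom f ≈ hom g
  ; id = λ {a} → id ,ₙ NHom-id (proj₂ a)
  ; _∘_ = λ f g → (hom f ∘ hom g) ,ₙ NHom-∘ (inN f) (inN g)
  ; equiv = record { refl = E.refl ; sym = E.sym ; trans = E.trans }
  ; ∘-resp-≈ = ∘-resp-≈
  ; assoc = assoc
  ; identityˡ = identityˡ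
  ; identityʳ = identityʳ
  }
  where
    open Category C
    open Subcategory S
    module E {A B} = IsEquivalence (equiv {A} {B})

record IMLU (o h e p : Level) : Set (lsuc (o ⊔ h ⊔ e ⊔ p)) where
  field
    M : Category o h e
    LM : Notions.FiniteLimits M
    HM : Notions.WithLimits.IsHeyting M LM
    S : Subcategory M p

  open Category M public
  open Subcategory S public
  module MN = Notions M
  open MN.FiniteLimits LM public
  open MN.WithLimits LM public using (IsExists; IsForall)
  open NaryProducts M LM public

  N : Category (o ⊔ p) (h ⊔ p) e
  N = induced S

  module N = Category N
  module NN = Notions N

  field
    -- the fixed finite products of M restrict to products in N
    ⊤-in : NObj ⊤
    !-in : ∀ X → NHom (proj₁ (isTerminal X))
    ×-in : ∀ {A B} → NObj A → NObj B → NObj (A ×₀ B)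
    π₁-in : ∀ {A B} → NHom (MN.Product.π₁ (product A B))
    π₂-in : ∀ {A B} → NHom (MN.Product.π₂ (product A B))
    ⟨⟩-in : ∀ {X A B} {f : X ⇒ A} {g : X ⇒ B} → NHom f → NHom g → NHom ⟨ f , g ⟩
    pullbackN : ∀ {a b d : N.Obj} (f : a N.⇒ d) (g : b N.⇒ d) → NN.Pullback f g
    pullbackN-pres : ∀ {a b d : N.Obj} (f : a N.⇒ d) (g : b N.⇒ d) →
      MN.IsPullback (hom (NN.Pullback.p₁ (pullbackN f g))) (hom (NN.Pullback.p₂ (pullbackN f g)))
                    (hom f) (hom g)

  infixr 7 _×N_
  _×N_ : N.Obj → N.Obj → N.Obj
  a ×N b = (proj₁ a ×₀ proj₁ b) , ×-in (proj₂ a) (proj₂ b)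

  LN : NN.FiniteLimits
  LN = record
    { ⊤ = ⊤ , ⊤-in
    ; isTerminal = λ x → (proj₁ (isTerminal (proj₁ x)) ,ₙ !-in (proj₁ x))
                       , (λ g → proj₂ (isTerminal (proj₁ x)) (hom g))
    ; product = λ a b → record
        { obj = a ×N b
        ; π₁ = MN.Product.π₁ (product (proj₁ a) (proj₁ b)) ,ₙ π₁-in
        ; π₂ = MN.Product.π₂ (product (proj₁ a) (proj₁ b)) ,ₙ π₂-in
        ; isProduct = λ f g →
            let r = MN.Product.isProduct (product (proj₁ a) (proj₁ b)) (hom f) (hom g) in
            (proj₁ r ,ₙ ⟨⟩-in (inN f) (inN g)) , proj₁ (proj₂ r) , proj₁ (proj₂ (proj₂ r))
            , (λ k' e₁ e₂ → proj₂ (proj₂ (proj₂ r)) (hom k') e₁ e₂)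
        }
    ; pullback = pullbackN
    }

  field
    HN : NN.WithLimits.IsHeyting LN
    mono-pres : ∀ {a b : N.Obj} (f : a N.⇒ b) → NN.IsMono f → MN.IsMono (hom f)

  toM : ∀ {a : N.Obj} → NN.Mono a → MN.Mono (proj₁ a)
  toM m = record { dom = proj₁ (NN.dom m) ; arr = hom (NN.arr m)
                 ; isMono = mono-pres (NN.arr m) (NN.isMono m) }

  module HN = NN.WithLimits.IsHeyting HN

  field
    image-pres : ∀ {x a : N.Obj} (f : x N.⇒ a) → MN.IsImage (hom f) (toM (proj₁ (HN.image f)))
    bottom-pres : ∀ (a : N.Obj) → MN.IsBottom (hom (NN.arr (proj₁ (HN.bottom a))))
    join-pres : ∀ {a : N.Obj} (m n : NN.Mono a) →
      MN.IsJoin (hom (NN.arr m)) (hom (NN.arr n)) (hom (NN.arr (proj₁ (HN.join m n))))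
    exists-pres : ∀ {a b : N.Obj} (f : a N.⇒ b) (m : NN.Mono a) →
      IsExists (hom f) (toM m) (toM (proj₁ (HN.existsᶠ f m)))
    forallᶠ-pres : ∀ {a b : N.Obj} (f : a N.⇒ b) (m : NN.Mono a) →
      IsForall (hom f) (toM m) (toM (proj₁ (HN.forallᶠ f m)))
    conservative : ∀ {a b : N.Obj} (f : a N.⇒ b) → MN.IsIso (hom f) → NN.IsIso f

    U : N.Obj
    U-univ : ∀ (a : N.Obj) → Σ (a N.⇒ U) NN.IsMono

    T : Functor M M

  T₀ : Obj → Obj
  T₀ = Functor.F₀ T

  T₁ : ∀ {A B} → A ⇒ B → T₀ A ⇒ T₀ B
  T₁ = Functor.F₁ T

  field
    T-obj : ∀ {A} → NObj A → NObj (T₀ A)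
    T-hom : ∀ {A B} {f : A ⇒ B} → NHom f → NHom (T₁ f)
    ι : ∀ A → A ⇒ T₀ A
    ι⁻¹ : ∀ A → T₀ A ⇒ A
    ι-iso : ∀ A → (ι⁻¹ A ∘ ι A ≈ id) × (ι A ∘ ι⁻¹ A ≈ id)
    ι-natural : ∀ {A B} (f : A ⇒ B) → T₁ f ∘ ι A ≈ ι B ∘ f

  TN : Functor N N
  TN = record
    { F₀ = λ a → T₀ (proj₁ a) , T-obj (proj₂ a)
    ; F₁ = λ f → T₁ (hom f) ,ₙ T-hom (inN f)
    ; F-resp-≈ = Functor.F-resp-≈ T
    ; F-id = Functor.F-id T
    ; F-∘ = Functor.F-∘ T
    }

  field
    P : Functor N N

  P₀ : N.Obj → N.Obj
  P₀ = Functor.F₀ P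

  TN₀ : N.Obj → N.Obj
  TN₀ = Functor.F₀ TN

  field
    ⊆ : N.Obj → N.Obj
    m⊆ : ∀ a → ⊆ a N.⇒ (TN₀ a ×N P₀ a)
    m⊆-mono : ∀ a → MN.IsMono (hom (m⊆ a))

  IsPullbackOf⊆ : ∀ {a b r₀ : N.Obj} → proj₁ r₀ ⇒ (T₀ (proj₁ a) ×₀ proj₁ b)
                  → proj₁ b ⇒ proj₁ (P₀ a) → Set (o ⊔ h ⊔ e)
  IsPullbackOf⊆ {a} {b} {r₀} r χ =
    Σ (proj₁ r₀ ⇒ proj₁ (⊆ a)) λ r' → MN.IsPullback r r' (id ⊗ χ) (hom (m⊆ a))

  field
    ⊆-classify : ∀ (a b : N.Obj) {r₀ : N.Obj} (r : r₀ N.⇒ (TN₀ a ×N b)) → MN.IsMono (hom r) →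
      Σ (b N.⇒ P₀ a) λ χ → IsPullbackOf⊆ {a} {b} {r₀} (hom r) (hom χ)
        × (∀ (χ' : proj₁ b ⇒ proj₁ (P₀ a)) → IsPullbackOf⊆ {a} {b} {r₀} (hom r) χ' → χ' ≈ hom χ)

    μ : ∀ a → P₀ (TN₀ a) N.⇒ TN₀ (P₀ a)
    μ⁻¹ : ∀ a → TN₀ (P₀ a) N.⇒ P₀ (TN₀ a)
    μ-iso : ∀ a → (μ⁻¹ a N.∘ μ a N.≈ N.id) × (μ a N.∘ μ⁻¹ a N.≈ N.id)
    μ-natural : ∀ {a b} (f : a N.⇒ b) →
      Functor.F₁ TN (Functor.F₁ P f) N.∘ μ a N.≈ μ b N.∘ Functor.F₁ P (Functor.F₁ TN f)

module Submission where

-- For objects A₁ … Aₙ of N there is a canonical comparison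
-- map  κ : T(A₁ × … × Aₙ) → TA₁ × … × TAₙ  built from T applied to the
-- projections; it lies in N because T restricts to N and N is closed
-- under the products of M.  Naturality of ι gives  κ ∘ ι = ι × … × ι,
-- and since ι and ι × … × ι are isomorphisms of M, so is κ.  As N is
-- conservative in M, the inverse κ⁻¹ also lies in N, and
-- v = T u ∘ κ⁻¹  satisfies  v ∘ (ι × … × ι) = T u ∘ ι = ι ∘ u.

open import Defs
open import Level using (Level)
open import Data.Nat using (ℕ; zero; suc)
open import Data.Fin using (Fin) renaming (zero to fzero; suc to fsuc)
open import Data.Product using (Σ; _×_; proj₁; proj₂; _,_)
open import Relation.Binary.Bundles using (Setoid)
import Relation.Binary.Reasoning.Setoid as SetoidReasoning

module CategoryFacts {o h e : Level} (C : Category o h e) where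
  open Category C
  open Notions C using (IsIso)

  hom-setoid : Obj → Obj → Setoid h e
  hom-setoid A B = record { Carrier = A ⇒ B ; _≈_ = _≈_ ; isEquivalence = equiv }

  module HomReasoning {A B : Obj} = SetoidReasoning (hom-setoid A B)
  open HomReasoning

  ≈-refl : ∀ {A B} {f : A ⇒ B} → f ≈ f
  ≈-refl {A} {B} = Setoid.refl (hom-setoid A B)

  ∘-congˡ : ∀ {A B D} {f g : A ⇒ B} (k : B ⇒ D) → f ≈ g → k ∘ f ≈ k ∘ g
  ∘-congˡ k p = ∘-resp-≈ ≈-refl p

  ∘-congʳ : ∀ {A B D} {f g : B ⇒ D} (k : A ⇒ B) → f ≈ g → f ∘ k ≈ g ∘ k
  ∘-congʳ k p = ∘-resp-≈ p ≈-refl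

  id-comm : ∀ {A B} {f : A ⇒ B} → f ∘ id ≈ id ∘ f
  id-comm {f = f} = begin f ∘ id ≈⟨ identityʳ ⟩ f ≈⟨ identityˡ ⟨ id ∘ f ∎

  cancel-inner : ∀ {X A B D} {f : A ⇒ B} {g : B ⇒ A} (k : A ⇒ D) (x : X ⇒ A) →
    g ∘ f ≈ id → (k ∘ g) ∘ (f ∘ x) ≈ k ∘ x
  cancel-inner {f = f} {g} k x gf = begin
    (k ∘ g) ∘ (f ∘ x)  ≈⟨ assoc ⟩
    k ∘ (g ∘ (f ∘ x))  ≈⟨ ∘-congˡ k assoc ⟨
    k ∘ ((g ∘ f) ∘ x)  ≈⟨ ∘-congˡ k (∘-congʳ x gf) ⟩
    k ∘ (id ∘ x)       ≈⟨ ∘-congˡ k identityˡ ⟩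
    k ∘ x              ∎

  iso-cancelʳ : ∀ {A B D} {k : B ⇒ D} {a : A ⇒ B} {b : A ⇒ D} →
    IsIso a → IsIso b → k ∘ a ≈ b → IsIso k
  iso-cancelʳ {k = k} {a} {b} (a⁻¹ , a⁻¹a , aa⁻¹) (b⁻¹ , b⁻¹b , bb⁻¹) ka≈b =
    a ∘ b⁻¹ , left , right
    where
      k≈ba⁻¹ : k ≈ b ∘ a⁻¹
      k≈ba⁻¹ = begin
        k              ≈⟨ identityʳ ⟨
        k ∘ id         ≈⟨ ∘-congˡ k aa⁻¹ ⟨
        k ∘ (a ∘ a⁻¹)  ≈⟨ assoc ⟨
        (k ∘ a) ∘ a⁻¹  ≈⟨ ∘-congʳ a⁻¹ ka≈b ⟩
        b ∘ a⁻¹        ∎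
      left : (a ∘ b⁻¹) ∘ k ≈ id
      left = begin
        (a ∘ b⁻¹) ∘ k          ≈⟨ ∘-congˡ (a ∘ b⁻¹) k≈ba⁻¹ ⟩
        (a ∘ b⁻¹) ∘ (b ∘ a⁻¹)  ≈⟨ cancel-inner a a⁻¹ b⁻¹b ⟩
        a ∘ a⁻¹                ≈⟨ aa⁻¹ ⟩
        id                     ∎
      right : k ∘ (a ∘ b⁻¹) ≈ id
      right = begin
        k ∘ (a ∘ b⁻¹)          ≈⟨ ∘-congʳ (a ∘ b⁻¹) k≈ba⁻¹ ⟩
        (b ∘ a⁻¹) ∘ (a ∘ b⁻¹)  ≈⟨ cancel-inner b b⁻¹ a⁻¹a ⟩
        b ∘ b⁻¹                ≈⟨ bb⁻¹ ⟩
        id                     ∎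

module ProductFacts {o h e : Level} (C : Category o h e) (L : Notions.FiniteLimits C) where
  open Category C
  open Notions C using (IsIso; module Product)
  open Notions.FiniteLimits L
  open NaryProducts C L
  open CategoryFacts C
  open HomReasoning

  !-unique : ∀ {X} (f g : X ⇒ ⊤) → f ≈ g
  !-unique {X} f g = begin f ≈⟨ proj₂ (isTerminal X) f ⟩ _ ≈⟨ proj₂ (isTerminal X) g ⟨ g ∎

  π₁ : ∀ {A B} → A ×₀ B ⇒ A
  π₁ {A} {B} = Product.π₁ (product A B)

  π₂ : ∀ {A B} → A ×₀ B ⇒ B
  π₂ {A} {B} = Product.π₂ (product A B)

  π₁∘⟨⟩ : ∀ {X A B} (f : X ⇒ A) (g : X ⇒ B) → π₁ ∘ ⟨ f , g ⟩ ≈ f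
  π₁∘⟨⟩ {A = A} {B} f g = proj₁ (proj₂ (Product.isProduct (product A B) f g))

  π₂∘⟨⟩ : ∀ {X A B} (f : X ⇒ A) (g : X ⇒ B) → π₂ ∘ ⟨ f , g ⟩ ≈ g
  π₂∘⟨⟩ {A = A} {B} f g = proj₁ (proj₂ (proj₂ (Product.isProduct (product A B) f g)))

  ⟨⟩-unique : ∀ {X A B} {f : X ⇒ A} {g : X ⇒ B} (k : X ⇒ A ×₀ B) →
    π₁ ∘ k ≈ f → π₂ ∘ k ≈ g → k ≈ ⟨ f , g ⟩
  ⟨⟩-unique {A = A} {B} {f} {g} = proj₂ (proj₂ (proj₂ (Product.isProduct (product A B) f g)))

  ⟨⟩-cong : ∀ {X A B} {f f' : X ⇒ A} {g g' : X ⇒ B} →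
    f ≈ f' → g ≈ g' → ⟨ f , g ⟩ ≈ ⟨ f' , g' ⟩
  ⟨⟩-cong {f = f} {f'} {g} {g'} p q = ⟨⟩-unique ⟨ f , g ⟩
    (begin π₁ ∘ ⟨ f , g ⟩ ≈⟨ π₁∘⟨⟩ f g ⟩ f ≈⟨ p ⟩ f' ∎)
    (begin π₂ ∘ ⟨ f , g ⟩ ≈⟨ π₂∘⟨⟩ f g ⟩ g ≈⟨ q ⟩ g' ∎)

  ⟨⟩∘ : ∀ {Y X A B} (f : X ⇒ A) (g : X ⇒ B) (x : Y ⇒ X) →
    ⟨ f , g ⟩ ∘ x ≈ ⟨ f ∘ x , g ∘ x ⟩
  ⟨⟩∘ f g x = ⟨⟩-unique (⟨ f , g ⟩ ∘ x)
    (begin π₁ ∘ (⟨ f , g ⟩ ∘ x) ≈⟨ assoc ⟨ (π₁ ∘ ⟨ f , g ⟩) ∘ x ≈⟨ ∘-congʳ x (π₁∘⟨⟩ f g) ⟩ f ∘ x ∎)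
    (begin π₂ ∘ (⟨ f , g ⟩ ∘ x) ≈⟨ assoc ⟨ (π₂ ∘ ⟨ f , g ⟩) ∘ x ≈⟨ ∘-congʳ x (π₂∘⟨⟩ f g) ⟩ g ∘ x ∎)

  ⊗∘⟨⟩ : ∀ {X A A' B B'} (f : A ⇒ A') (g : B ⇒ B') (a : X ⇒ A) (b : X ⇒ B) →
    (f ⊗ g) ∘ ⟨ a , b ⟩ ≈ ⟨ f ∘ a , g ∘ b ⟩
  ⊗∘⟨⟩ f g a b = begin
    (f ⊗ g) ∘ ⟨ a , b ⟩                                     ≈⟨ ⟨⟩∘ (f ∘ π₁) (g ∘ π₂) ⟨ a , b ⟩ ⟩
    ⟨ (f ∘ π₁) ∘ ⟨ a , b ⟩ , (g ∘ π₂) ∘ ⟨ a , b ⟩ ⟩         ≈⟨ ⟨⟩-cong assoc assoc ⟩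
    ⟨ f ∘ (π₁ ∘ ⟨ a , b ⟩) , g ∘ (π₂ ∘ ⟨ a , b ⟩) ⟩         ≈⟨ ⟨⟩-cong (∘-congˡ f (π₁∘⟨⟩ a b))
                                                                        (∘-congˡ g (π₂∘⟨⟩ a b)) ⟩
    ⟨ f ∘ a , g ∘ b ⟩                                       ∎

  ⊗∘⊗ : ∀ {A A' A'' B B' B''} (f : A' ⇒ A'') (g : B' ⇒ B'') (f' : A ⇒ A') (g' : B ⇒ B') →
    (f ⊗ g) ∘ (f' ⊗ g') ≈ (f ∘ f') ⊗ (g ∘ g')
  ⊗∘⊗ f g f' g' = begin
    (f ⊗ g) ∘ (f' ⊗ g')                         ≈⟨ ⊗∘⟨⟩ f g (f' ∘ π₁) (g' ∘ π₂) ⟩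
    ⟨ f ∘ (f' ∘ π₁) , g ∘ (g' ∘ π₂) ⟩           ≈⟨ ⟨⟩-cong assoc assoc ⟨
    (f ∘ f') ⊗ (g ∘ g')                         ∎

  ⊗-cong : ∀ {A A' B B'} {f f' : A ⇒ A'} {g g' : B ⇒ B'} →
    f ≈ f' → g ≈ g' → f ⊗ g ≈ f' ⊗ g'
  ⊗-cong p q = ⟨⟩-cong (∘-congʳ π₁ p) (∘-congʳ π₂ q)

  ⊗-id : ∀ {A B} {f : A ⇒ A} {g : B ⇒ B} → f ≈ id → g ≈ id → f ⊗ g ≈ id
  ⊗-id {f = f} {g} p q = begin
    f ⊗ g                  ≈⟨ ⊗-cong p q ⟩
    ⟨ id ∘ π₁ , id ∘ π₂ ⟩  ≈⟨ ⟨⟩-unique id id-comm id-comm ⟨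
    id                     ∎

  ∏₁-∘ : ∀ n {A B D : Fin n → Obj} (f : ∀ i → B i ⇒ D i) (g : ∀ i → A i ⇒ B i) →
    ∏₁ n f ∘ ∏₁ n g ≈ ∏₁ n (λ i → f i ∘ g i)
  ∏₁-∘ zero f g = identityˡ
  ∏₁-∘ (suc zero) f g = ≈-refl
  ∏₁-∘ (suc (suc n)) f g = begin
    (f fzero ⊗ ∏₁ (suc n) (λ i → f (fsuc i))) ∘ (g fzero ⊗ ∏₁ (suc n) (λ i → g (fsuc i)))
      ≈⟨ ⊗∘⊗ _ _ _ _ ⟩
    (f fzero ∘ g fzero) ⊗ (∏₁ (suc n) (λ i → f (fsuc i)) ∘ ∏₁ (suc n) (λ i → g (fsuc i)))
      ≈⟨ ⊗-cong ≈-refl (∏₁-∘ (suc n) _ _) ⟩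
    (f fzero ∘ g fzero) ⊗ ∏₁ (suc n) (λ i → f (fsuc i) ∘ g (fsuc i))
      ∎

  ∏₁-id : ∀ n {A : Fin n → Obj} (f : ∀ i → A i ⇒ A i) → (∀ i → f i ≈ id) → ∏₁ n f ≈ id
  ∏₁-id zero f q = ≈-refl
  ∏₁-id (suc zero) f q = q fzero
  ∏₁-id (suc (suc n)) f q = ⊗-id (q fzero) (∏₁-id (suc n) _ (λ i → q (fsuc i)))

  ∏₁-iso : ∀ n {A B : Fin n → Obj} (f : ∀ i → A i ⇒ B i) → (∀ i → IsIso (f i)) → IsIso (∏₁ n f)
  ∏₁-iso n {A} {B} f isos = ∏₁ n f⁻¹ , left , right
    where
      f⁻¹ : ∀ i → B i ⇒ A i
      f⁻¹ i = proj₁ (isos i)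
      left : ∏₁ n f⁻¹ ∘ ∏₁ n f ≈ id
      left = begin
        ∏₁ n f⁻¹ ∘ ∏₁ n f          ≈⟨ ∏₁-∘ n f⁻¹ f ⟩
        ∏₁ n (λ i → f⁻¹ i ∘ f i)   ≈⟨ ∏₁-id n _ (λ i → proj₁ (proj₂ (isos i))) ⟩
        id                         ∎
      right : ∏₁ n f ∘ ∏₁ n f⁻¹ ≈ id
      right = begin
        ∏₁ n f ∘ ∏₁ n f⁻¹          ≈⟨ ∏₁-∘ n f f⁻¹ ⟩
        ∏₁ n (λ i → f i ∘ f⁻¹ i)   ≈⟨ ∏₁-id n _ (λ i → proj₂ (proj₂ (isos i))) ⟩
        id                         ∎

module ComparisonMap {o h e p : Level} (I : IMLU o h e p) where
  open IMLU I
  open CategoryFacts M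
  open HomReasoning
  open ProductFacts M LM

  ι-isIso : ∀ A → MN.IsIso (ι A)
  ι-isIso A = ι⁻¹ A , ι-iso A

  ∏-inN : ∀ n (A : Fin n → Obj) → (∀ i → NObj (A i)) → NObj (∏ n A)
  ∏-inN zero A obj-inN = ⊤-in
  ∏-inN (suc zero) A obj-inN = obj-inN fzero
  ∏-inN (suc (suc n)) A obj-inN =
    ×-in (obj-inN fzero) (∏-inN (suc n) (λ i → A (fsuc i)) (λ i → obj-inN (fsuc i)))

  comparison : ∀ n (A : Fin n → Obj) → T₀ (∏ n A) ⇒ ∏ n (λ i → T₀ (A i))
  comparison zero A = proj₁ (isTerminal (T₀ ⊤))
  comparison (suc zero) A = id
  comparison (suc (suc n)) A = ⟨ T₁ π₁ , comparison (suc n) (λ i → A (fsuc i)) ∘ T₁ π₂ ⟩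

  comparison-inN : ∀ n (A : Fin n → Obj) → (∀ i → NObj (A i)) → NHom (comparison n A)
  comparison-inN zero A obj-inN = !-in (T₀ ⊤)
  comparison-inN (suc zero) A obj-inN = NHom-id (T-obj (obj-inN fzero))
  comparison-inN (suc (suc n)) A obj-inN =
    ⟨⟩-in (T-hom π₁-in)
          (NHom-∘ (comparison-inN (suc n) (λ i → A (fsuc i)) (λ i → obj-inN (fsuc i))) (T-hom π₂-in))

  pairing-ι : ∀ {A A' B'} (k : T₀ A' ⇒ B') (f : A' ⇒ B') → k ∘ ι A' ≈ f →
    ⟨ T₁ π₁ , k ∘ T₁ π₂ ⟩ ∘ ι (A ×₀ A') ≈ ι A ⊗ f
  pairing-ι {A} {A'} k f k∘ι≈f = begin
    ⟨ T₁ π₁ , k ∘ T₁ π₂ ⟩ ∘ ι X          ≈⟨ ⟨⟩∘ (T₁ π₁) (k ∘ T₁ π₂) (ι X) ⟩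
    ⟨ T₁ π₁ ∘ ι X , (k ∘ T₁ π₂) ∘ ι X ⟩  ≈⟨ ⟨⟩-cong (ι-natural π₁) second ⟩
    ⟨ ι A ∘ π₁ , f ∘ π₂ ⟩                ∎
    where
      X : Obj
      X = A ×₀ A'
      second : (k ∘ T₁ π₂) ∘ ι X ≈ f ∘ π₂
      second = begin
        (k ∘ T₁ π₂) ∘ ι X    ≈⟨ assoc ⟩
        k ∘ (T₁ π₂ ∘ ι X)    ≈⟨ ∘-congˡ k (ι-natural π₂) ⟩
        k ∘ (ι A' ∘ π₂)      ≈⟨ assoc ⟨
        (k ∘ ι A') ∘ π₂      ≈⟨ ∘-congʳ π₂ k∘ι≈f ⟩
        f ∘ π₂               ∎

  -- naturality of ι turns κ ∘ ι into ι × … × ι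
  comparison-ι : ∀ n (A : Fin n → Obj) →
    comparison n A ∘ ι (∏ n A) ≈ ∏₁ n (λ i → ι (A i))
  comparison-ι zero A = !-unique _ _
  comparison-ι (suc zero) A = identityˡ
  comparison-ι (suc (suc n)) A =
    pairing-ι (comparison (suc n) (λ i → A (fsuc i))) (∏₁ (suc n) (λ i → ι (A (fsuc i))))
              (comparison-ι (suc n) (λ i → A (fsuc i)))

  -- κ is an isomorphism of M, being the composite of ι × … × ι with ι⁻¹
  comparison-isIso : ∀ n (A : Fin n → Obj) → MN.IsIso (comparison n A)
  comparison-isIso n A =
    iso-cancelʳ (ι-isIso (∏ n A)) (∏₁-iso n (λ i → ι (A i)) (λ i → ι-isIso (A i))) (comparison-ι n A)

  -- by conservativity, κ has an inverse lying in N
  comparison-inverseN : ∀ n (A : Fin n → N.Obj) →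
    let A₀ = λ i → proj₁ (A i) in
    Σ (∏ n (λ i → T₀ (A₀ i)) ⇒ T₀ (∏ n A₀)) λ g → NHom g × (g ∘ comparison n A₀ ≈ id)
  comparison-inverseN n A = hom g , inN g , g∘κ≈id
    where
      A₀ : Fin n → Obj
      A₀ i = proj₁ (A i)
      source target : N.Obj
      source = T₀ (∏ n A₀) , T-obj (∏-inN n A₀ (λ i → proj₂ (A i)))
      target = ∏ n (λ i → T₀ (A₀ i)) , ∏-inN n _ (λ i → T-obj (proj₂ (A i)))
      κ : source N.⇒ target
      κ = comparison n A₀ ,ₙ comparison-inN n A₀ (λ i → proj₂ (A i))
      κ-isIsoN : NN.IsIso κ
      κ-isIsoN = conservative κ (comparison-isIso n A₀)
      g : target N.⇒ source
      g = proj₁ κ-isIsoN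
      g∘κ≈id : hom g ∘ comparison n A₀ ≈ id
      g∘κ≈id = proj₁ (proj₂ κ-isIsoN)

mainTheorem19 : ∀ {o h e p : Level} (I : IMLU o h e p) → let open IMLU I in
    (n : ℕ) (A : Fin n → N.Obj) (B : N.Obj)
    (u : ∏ n (λ i → proj₁ (A i)) ⇒ proj₁ B) → NHom u →
    Σ (∏ n (λ i → T₀ (proj₁ (A i))) ⇒ T₀ (proj₁ B)) λ v →
    NHom v × (ι (proj₁ B) ∘ u ≈ v ∘ ∏₁ n (λ i → ι (proj₁ (A i))))
mainTheorem19 I n A B u u-inN = T₁ u ∘ κ⁻¹ , NHom-∘ (T-hom u-inN) κ⁻¹-inN , square
  where
    open IMLU I
    open CategoryFacts M
    open HomReasoning
    open ComparisonMap I
    A₀ : Fin n → Obj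
    A₀ i = proj₁ (A i)
    κ⁻¹ : ∏ n (λ i → T₀ (A₀ i)) ⇒ T₀ (∏ n A₀)
    κ⁻¹ = proj₁ (comparison-inverseN n A)
    κ⁻¹-inN : NHom κ⁻¹
    κ⁻¹-inN = proj₁ (proj₂ (comparison-inverseN n A))
    κ⁻¹∘κ≈id : κ⁻¹ ∘ comparison n A₀ ≈ id
    κ⁻¹∘κ≈id = proj₂ (proj₂ (comparison-inverseN n A))
    square : ι (proj₁ B) ∘ u ≈ (T₁ u ∘ κ⁻¹) ∘ ∏₁ n (λ i → ι (A₀ i))
    square = begin
      ι (proj₁ B) ∘ u                                 ≈⟨ ι-natural u ⟨
      T₁ u ∘ ι (∏ n A₀)                               ≈⟨ cancel-inner (T₁ u) (ι (∏ n A₀)) κ⁻¹∘κ≈id ⟨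
      (T₁ u ∘ κ⁻¹) ∘ (comparison n A₀ ∘ ι (∏ n A₀))   ≈⟨ ∘-congˡ (T₁ u ∘ κ⁻¹) (comparison-ι n A₀) ⟩
      (T₁ u ∘ κ⁻¹) ∘ ∏₁ n (λ i → ι (A₀ i))            ∎
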